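{- Let $G$ be a $(2P_1+P_3,\,K_4-e)$-free graph. If $G$ contains an induced $C_5+K_1$, then $G$ has a vertex of degree at most $5$.
   Context: All graphs are finite and simple. $P_\ell$ is the induced path and $C_\ell$ the induced cycle on $\ell$ vertices; $K_4-e$ is $K_4$ minus an edge; $+$ denotes disjoint union, so $2P_1+P_3$ is two isolated vertices plus a $P_3$, and $C_5+K_1$ is a $5$-cycle plus an isolated vertex. "$(H_1,H_2)$-free" means no induced subgraph isomorphic to $H_1$ or $H_2$. -}

module Defs where

open import Data.Nat using (ℕ; zero; suc)
open import Data.Bool using (Bool; true; false; _∨_)
open import Data.Fin using (Fin; zero; suc; _≟_)
open import Data.List using (List; []; _∷_; length; filter; any)
open import Data.List.Base using (allFin)
open import Data.Product using (_×_; _,_; Σ)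
open import Relation.Binary.PropositionalEquality using (_≡_; refl)
open import Relation.Nullary.Decidable using (⌊_⌋)
open import Data.Bool.Properties using (T?)
open import Data.Bool using (T)
open import Function.Definitions using (Injective)

record Graph (n : ℕ) : Set where
  field
    adj   : Fin n → Fin n → Bool
    sym   : ∀ u v → adj u v ≡ adj v u
    irrefl : ∀ v → adj v v ≡ false
open Graph public

degree : ∀ {n} → Graph n → Fin n → ℕ
degree G v = length (filter (λ u → T? (adj G v u)) (allFin _))

record InducedCopy {k n : ℕ} (H : Graph k) (G : Graph n) : Set where
  field
    f      : Fin k → Fin n
    inj    : Injective _≡_ _≡_ f
    preserve : ∀ i j → adj G (f i) (f j) ≡ adj H i j
open InducedCopy public

Free : ∀ {k n} → Graph k → Graph n → Set
Free H G = InducedCopy H G → Data.Empty.⊥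
  where import Data.Empty


-- Pattern graphs (vertices 0..k-1):
-- 2P1+P3 : isolated 0,1; path 2-3-4
-- K4-e   : K4 on 0..3 minus edge {2,3}
-- C5+K1  : cycle 0-1-2-3-4-0, isolated 5
twoP1+P3-adj : Fin 5 → Fin 5 → Bool
twoP1+P3-adj zero zero = false
twoP1+P3-adj zero (suc zero) = false
twoP1+P3-adj zero (suc (suc zero)) = false
twoP1+P3-adj zero (suc (suc (suc zero))) = false
twoP1+P3-adj zero (suc (suc (suc (suc zero)))) = false
twoP1+P3-adj (suc zero) zero = false
twoP1+P3-adj (suc zero) (suc zero) = false
twoP1+P3-adj (suc zero) (suc (suc zero)) = false
twoP1+P3-adj (suc zero) (suc (suc (suc zero))) = false
twoP1+P3-adj (suc zero) (suc (suc (suc (suc zero)))) = false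
twoP1+P3-adj (suc (suc zero)) zero = false
twoP1+P3-adj (suc (suc zero)) (suc zero) = false
twoP1+P3-adj (suc (suc zero)) (suc (suc zero)) = false
twoP1+P3-adj (suc (suc zero)) (suc (suc (suc zero))) = true
twoP1+P3-adj (suc (suc zero)) (suc (suc (suc (suc zero)))) = false
twoP1+P3-adj (suc (suc (suc zero))) zero = false
twoP1+P3-adj (suc (suc (suc zero))) (suc zero) = false
twoP1+P3-adj (suc (suc (suc zero))) (suc (suc zero)) = true
twoP1+P3-adj (suc (suc (suc zero))) (suc (suc (suc zero))) = false
twoP1+P3-adj (suc (suc (suc zero))) (suc (suc (suc (suc zero)))) = true
twoP1+P3-adj (suc (suc (suc (suc zero)))) zero = false
twoP1+P3-adj (suc (suc (suc (suc zero)))) (suc zero) = false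
twoP1+P3-adj (suc (suc (suc (suc zero)))) (suc (suc zero)) = false
twoP1+P3-adj (suc (suc (suc (suc zero)))) (suc (suc (suc zero))) = true
twoP1+P3-adj (suc (suc (suc (suc zero)))) (suc (suc (suc (suc zero)))) = false
twoP1+P3-sym : ∀ u v → twoP1+P3-adj u v ≡ twoP1+P3-adj v u
twoP1+P3-sym zero zero = refl
twoP1+P3-sym zero (suc zero) = refl
twoP1+P3-sym zero (suc (suc zero)) = refl
twoP1+P3-sym zero (suc (suc (suc zero))) = refl
twoP1+P3-sym zero (suc (suc (suc (suc zero)))) = refl
twoP1+P3-sym (suc zero) zero = refl
twoP1+P3-sym (suc zero) (suc zero) = refl
twoP1+P3-sym (suc zero) (suc (suc zero)) = refl
twoP1+P3-sym (suc zero) (suc (suc (suc zero))) = refl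
twoP1+P3-sym (suc zero) (suc (suc (suc (suc zero)))) = refl
twoP1+P3-sym (suc (suc zero)) zero = refl
twoP1+P3-sym (suc (suc zero)) (suc zero) = refl
twoP1+P3-sym (suc (suc zero)) (suc (suc zero)) = refl
twoP1+P3-sym (suc (suc zero)) (suc (suc (suc zero))) = refl
twoP1+P3-sym (suc (suc zero)) (suc (suc (suc (suc zero)))) = refl
twoP1+P3-sym (suc (suc (suc zero))) zero = refl
twoP1+P3-sym (suc (suc (suc zero))) (suc zero) = refl
twoP1+P3-sym (suc (suc (suc zero))) (suc (suc zero)) = refl
twoP1+P3-sym (suc (suc (suc zero))) (suc (suc (suc zero))) = refl
twoP1+P3-sym (suc (suc (suc zero))) (suc (suc (suc (suc zero)))) = refl
twoP1+P3-sym (suc (suc (suc (suc zero)))) zero = refl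
twoP1+P3-sym (suc (suc (suc (suc zero)))) (suc zero) = refl
twoP1+P3-sym (suc (suc (suc (suc zero)))) (suc (suc zero)) = refl
twoP1+P3-sym (suc (suc (suc (suc zero)))) (suc (suc (suc zero))) = refl
twoP1+P3-sym (suc (suc (suc (suc zero)))) (suc (suc (suc (suc zero)))) = refl
twoP1+P3-irr : ∀ v → twoP1+P3-adj v v ≡ false
twoP1+P3-irr zero = refl
twoP1+P3-irr (suc zero) = refl
twoP1+P3-irr (suc (suc zero)) = refl
twoP1+P3-irr (suc (suc (suc zero))) = refl
twoP1+P3-irr (suc (suc (suc (suc zero)))) = refl
twoP1+P3 : Graph 5
twoP1+P3 = record { adj = twoP1+P3-adj ; sym = twoP1+P3-sym ; irrefl = twoP1+P3-irr }

K4-e-adj : Fin 4 → Fin 4 → Bool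
K4-e-adj zero zero = false
K4-e-adj zero (suc zero) = true
K4-e-adj zero (suc (suc zero)) = true
K4-e-adj zero (suc (suc (suc zero))) = true
K4-e-adj (suc zero) zero = true
K4-e-adj (suc zero) (suc zero) = false
K4-e-adj (suc zero) (suc (suc zero)) = true
K4-e-adj (suc zero) (suc (suc (suc zero))) = true
K4-e-adj (suc (suc zero)) zero = true
K4-e-adj (suc (suc zero)) (suc zero) = true
K4-e-adj (suc (suc zero)) (suc (suc zero)) = false
K4-e-adj (suc (suc zero)) (suc (suc (suc zero))) = false
K4-e-adj (suc (suc (suc zero))) zero = true
K4-e-adj (suc (suc (suc zero))) (suc zero) = true
K4-e-adj (suc (suc (suc zero))) (suc (suc zero)) = false
K4-e-adj (suc (suc (suc zero))) (suc (suc (suc zero))) = false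
K4-e-sym : ∀ u v → K4-e-adj u v ≡ K4-e-adj v u
K4-e-sym zero zero = refl
K4-e-sym zero (suc zero) = refl
K4-e-sym zero (suc (suc zero)) = refl
K4-e-sym zero (suc (suc (suc zero))) = refl
K4-e-sym (suc zero) zero = refl
K4-e-sym (suc zero) (suc zero) = refl
K4-e-sym (suc zero) (suc (suc zero)) = refl
K4-e-sym (suc zero) (suc (suc (suc zero))) = refl
K4-e-sym (suc (suc zero)) zero = refl
K4-e-sym (suc (suc zero)) (suc zero) = refl
K4-e-sym (suc (suc zero)) (suc (suc zero)) = refl
K4-e-sym (suc (suc zero)) (suc (suc (suc zero))) = refl
K4-e-sym (suc (suc (suc zero))) zero = refl
K4-e-sym (suc (suc (suc zero))) (suc zero) = refl
K4-e-sym (suc (suc (suc zero))) (suc (suc zero)) = refl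
K4-e-sym (suc (suc (suc zero))) (suc (suc (suc zero))) = refl
K4-e-irr : ∀ v → K4-e-adj v v ≡ false
K4-e-irr zero = refl
K4-e-irr (suc zero) = refl
K4-e-irr (suc (suc zero)) = refl
K4-e-irr (suc (suc (suc zero))) = refl
K4-e : Graph 4
K4-e = record { adj = K4-e-adj ; sym = K4-e-sym ; irrefl = K4-e-irr }

C5+K1-adj : Fin 6 → Fin 6 → Bool
C5+K1-adj zero zero = false
C5+K1-adj zero (suc zero) = true
C5+K1-adj zero (suc (suc zero)) = false
C5+K1-adj zero (suc (suc (suc zero))) = false
C5+K1-adj zero (suc (suc (suc (suc zero)))) = true
C5+K1-adj zero (suc (suc (suc (suc (suc zero))))) = false
C5+K1-adj (suc zero) zero = true
C5+K1-adj (suc zero) (suc zero) = false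
C5+K1-adj (suc zero) (suc (suc zero)) = true
C5+K1-adj (suc zero) (suc (suc (suc zero))) = false
C5+K1-adj (suc zero) (suc (suc (suc (suc zero)))) = false
C5+K1-adj (suc zero) (suc (suc (suc (suc (suc zero))))) = false
C5+K1-adj (suc (suc zero)) zero = false
C5+K1-adj (suc (suc zero)) (suc zero) = true
C5+K1-adj (suc (suc zero)) (suc (suc zero)) = false
C5+K1-adj (suc (suc zero)) (suc (suc (suc zero))) = true
C5+K1-adj (suc (suc zero)) (suc (suc (suc (suc zero)))) = false
C5+K1-adj (suc (suc zero)) (suc (suc (suc (suc (suc zero))))) = false
C5+K1-adj (suc (suc (suc zero))) zero = false
C5+K1-adj (suc (suc (suc zero))) (suc zero) = false
C5+K1-adj (suc (suc (suc zero))) (suc (suc zero)) = true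
C5+K1-adj (suc (suc (suc zero))) (suc (suc (suc zero))) = false
C5+K1-adj (suc (suc (suc zero))) (suc (suc (suc (suc zero)))) = true
C5+K1-adj (suc (suc (suc zero))) (suc (suc (suc (suc (suc zero))))) = false
C5+K1-adj (suc (suc (suc (suc zero)))) zero = true
C5+K1-adj (suc (suc (suc (suc zero)))) (suc zero) = false
C5+K1-adj (suc (suc (suc (suc zero)))) (suc (suc zero)) = false
C5+K1-adj (suc (suc (suc (suc zero)))) (suc (suc (suc zero))) = true
C5+K1-adj (suc (suc (suc (suc zero)))) (suc (suc (suc (suc zero)))) = false
C5+K1-adj (suc (suc (suc (suc zero)))) (suc (suc (suc (suc (suc zero))))) = false
C5+K1-adj (suc (suc (suc (suc (suc zero))))) zero = false
C5+K1-adj (suc (suc (suc (suc (suc zero))))) (suc zero) = false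
C5+K1-adj (suc (suc (suc (suc (suc zero))))) (suc (suc zero)) = false
C5+K1-adj (suc (suc (suc (suc (suc zero))))) (suc (suc (suc zero))) = false
C5+K1-adj (suc (suc (suc (suc (suc zero))))) (suc (suc (suc (suc zero)))) = false
C5+K1-adj (suc (suc (suc (suc (suc zero))))) (suc (suc (suc (suc (suc zero))))) = false
C5+K1-sym : ∀ u v → C5+K1-adj u v ≡ C5+K1-adj v u
C5+K1-sym zero zero = refl
C5+K1-sym zero (suc zero) = refl
C5+K1-sym zero (suc (suc zero)) = refl
C5+K1-sym zero (suc (suc (suc zero))) = refl
C5+K1-sym zero (suc (suc (suc (suc zero)))) = refl
C5+K1-sym zero (suc (suc (suc (suc (suc zero))))) = refl
C5+K1-sym (suc zero) zero = refl
C5+K1-sym (suc zero) (suc zero) = refl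
C5+K1-sym (suc zero) (suc (suc zero)) = refl
C5+K1-sym (suc zero) (suc (suc (suc zero))) = refl
C5+K1-sym (suc zero) (suc (suc (suc (suc zero)))) = refl
C5+K1-sym (suc zero) (suc (suc (suc (suc (suc zero))))) = refl
C5+K1-sym (suc (suc zero)) zero = refl
C5+K1-sym (suc (suc zero)) (suc zero) = refl
C5+K1-sym (suc (suc zero)) (suc (suc zero)) = refl
C5+K1-sym (suc (suc zero)) (suc (suc (suc zero))) = refl
C5+K1-sym (suc (suc zero)) (suc (suc (suc (suc zero)))) = refl
C5+K1-sym (suc (suc zero)) (suc (suc (suc (suc (suc zero))))) = refl
C5+K1-sym (suc (suc (suc zero))) zero = refl
C5+K1-sym (suc (suc (suc zero))) (suc zero) = refl
C5+K1-sym (suc (suc (suc zero))) (suc (suc zero)) = refl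
C5+K1-sym (suc (suc (suc zero))) (suc (suc (suc zero))) = refl
C5+K1-sym (suc (suc (suc zero))) (suc (suc (suc (suc zero)))) = refl
C5+K1-sym (suc (suc (suc zero))) (suc (suc (suc (suc (suc zero))))) = refl
C5+K1-sym (suc (suc (suc (suc zero)))) zero = refl
C5+K1-sym (suc (suc (suc (suc zero)))) (suc zero) = refl
C5+K1-sym (suc (suc (suc (suc zero)))) (suc (suc zero)) = refl
C5+K1-sym (suc (suc (suc (suc zero)))) (suc (suc (suc zero))) = refl
C5+K1-sym (suc (suc (suc (suc zero)))) (suc (suc (suc (suc zero)))) = refl
C5+K1-sym (suc (suc (suc (suc zero)))) (suc (suc (suc (suc (suc zero))))) = refl
C5+K1-sym (suc (suc (suc (suc (suc zero))))) zero = refl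
C5+K1-sym (suc (suc (suc (suc (suc zero))))) (suc zero) = refl
C5+K1-sym (suc (suc (suc (suc (suc zero))))) (suc (suc zero)) = refl
C5+K1-sym (suc (suc (suc (suc (suc zero))))) (suc (suc (suc zero))) = refl
C5+K1-sym (suc (suc (suc (suc (suc zero))))) (suc (suc (suc (suc zero)))) = refl
C5+K1-sym (suc (suc (suc (suc (suc zero))))) (suc (suc (suc (suc (suc zero))))) = refl
C5+K1-irr : ∀ v → C5+K1-adj v v ≡ false
C5+K1-irr zero = refl
C5+K1-irr (suc zero) = refl
C5+K1-irr (suc (suc zero)) = refl
C5+K1-irr (suc (suc (suc zero))) = refl
C5+K1-irr (suc (suc (suc (suc zero)))) = refl
C5+K1-irr (suc (suc (suc (suc (suc zero))))) = refl
C5+K1 : Graph 6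
C5+K1 = record { adj = C5+K1-adj ; sym = C5+K1-sym ; irrefl = C5+K1-irr }

-- Let c₀ … c₄ be the induced C₅ and x the isolated vertex of the C₅+K₁.  By (K₄−e)-freeness
-- every neighbour u of c₀ misses (is non-adjacent to both ends of) one of the non-edges c₁c₃,
-- c₂c₄, c₁c₄ of the cycle, and if u ∉ {c₁, c₄} then (2P₁+P₃)-freeness forces u to be adjacent
-- to x.  Two such neighbours u, w of c₀ missing the same non-edge ab are equal: if adjacent they
-- span a K₄−e with x and c₀, otherwise u x w is a P₃ beside a and b.  So c₀ has at most
-- 2 + 3 neighbours.
module Submission where

open import Defs hiding (sym)
open import Data.Nat using (_≤_; s<s)
open import Data.Fin using (Fin; zero; suc; _≟_; _<_; #_)
open import Data.Fin.Properties using (<-cmp; injective⇒≤)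
open import Data.Product using (Σ; ∃; _×_; _,_; proj₁; proj₂)
open import Data.Bool using (true; false)
open import Data.Bool.Properties using (T?; T-≡)
open import Function.Bundles using (Equivalence)
open import Data.Empty using (⊥; ⊥-elim)
open import Data.List using (List; _∷_; length; filter; lookup; tabulate; allFin)
open import Data.List.Relation.Unary.All as All using ([]; _∷_)
open import Data.List.Relation.Unary.All.Properties using (tabulate⁻)
open import Data.List.Relation.Unary.AllPairs using (AllPairs; []; _∷_)
open import Data.List.Relation.Unary.Unique.Propositional using (Unique)
open import Data.List.Relation.Unary.Unique.Propositional.Properties using (allFin⁺; filter⁺)
open import Data.List.Membership.Propositional using (_∈_)
open import Data.List.Membership.Propositional.Properties using (∈-lookup; ∈-filter⁻)
import Data.Vec as Vec
open import Function.Definitions using (Injective)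
open import Relation.Binary using (tri<; tri≈; tri>)
open import Relation.Binary.PropositionalEquality
  using (_≡_; _≢_; refl; sym; trans; cong; subst)
open import Relation.Nullary using (yes; no; contradiction)
open import Relation.Nullary.Decidable using (False; toWitnessFalse)

lookup-injective : ∀ {a} {A : Set a} {xs : List A} → Unique xs →
                   ∀ {i j} → lookup xs i ≡ lookup xs j → i ≡ j
lookup-injective (_ ∷ _)        {zero}  {zero}  _  = refl
lookup-injective {xs = _ ∷ xs} (x∉ ∷ _) {zero}  {suc j} eq =
  contradiction eq (All.lookup x∉ (∈-lookup {xs = xs} j))
lookup-injective {xs = _ ∷ xs} (x∉ ∷ _) {suc i} {zero}  eq =
  contradiction (sym eq) (All.lookup x∉ (∈-lookup {xs = xs} i))
lookup-injective (_ ∷ uniq)     {suc i} {suc j} eq = cong suc (lookup-injective uniq eq)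

length≤-if-coveredBySubsingletons :
  ∀ {a p} {A : Set a} {k} {xs : List A} (P : Fin k → A → Set p) → Unique xs →
  (∀ {u} → u ∈ xs → ∃ λ i → P i u) →
  (∀ {i u w} → u ∈ xs → w ∈ xs → P i u → P i w → u ≡ w) →
  length xs ≤ k
length≤-if-coveredBySubsingletons {k = k} {xs = xs} P uniq cover subsingleton =
  injective⇒≤ class-injective
  where
  class : Fin (length xs) → Fin k
  class i = proj₁ (cover (∈-lookup i))

  class-injective : Injective _≡_ _≡_ class
  class-injective {i} {j} eq = lookup-injective uniq
    (subsingleton (∈-lookup i) (∈-lookup j)
      (subst (λ c → P c (lookup xs i)) eq (proj₂ (cover (∈-lookup i))))
      (proj₂ (cover (∈-lookup j))))

AllPairs-tabulate⁻ : ∀ {a r} {A : Set a} {R : A → A → Set r} {k} {g : Fin k → A} →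
                     AllPairs R (tabulate g) → ∀ {i j} → i < j → R (g i) (g j)
AllPairs-tabulate⁻ (px ∷ _)  {zero}  {suc j} _         = tabulate⁻ px j
AllPairs-tabulate⁻ (_ ∷ pxs) {suc i} {suc j} (s<s i<j) = AllPairs-tabulate⁻ pxs i<j

module _ {n} (G : Graph n) where

  neighbours : Fin n → List (Fin n)
  neighbours v = filter (λ u → T? (adj G v u)) (allFin n)

  adjacent-if-∈-neighbours : ∀ {u v} → u ∈ neighbours v → adj G v u ≡ true
  adjacent-if-∈-neighbours {v = v} u∈ =
    Equivalence.to T-≡ (proj₂ (∈-filter⁻ (λ u → T? (adj G v u)) {xs = allFin n} u∈))

  degree≤-if-coveredBySubsingletons :
    ∀ {p k} v (P : Fin k → Fin n → Set p) →
    (∀ {u} → adj G v u ≡ true → ∃ λ i → P i u) →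
    (∀ {i u w} → adj G v u ≡ true → adj G v w ≡ true → P i u → P i w → u ≡ w) →
    degree G v ≤ k
  degree≤-if-coveredBySubsingletons v P cover subsingleton =
    length≤-if-coveredBySubsingletons P (filter⁺ _ (allFin⁺ n))
      (λ u∈ → cover (adjacent-if-∈-neighbours u∈))
      (λ u∈ w∈ → subsingleton (adjacent-if-∈-neighbours u∈) (adjacent-if-∈-neighbours w∈))

  adj-flip : ∀ {u v b} → adj G u v ≡ b → adj G v u ≡ b
  adj-flip {u} {v} uv = trans (Graph.sym G v u) uv

  adjacent⇒≢ : ∀ {u v} → adj G u v ≡ true → u ≢ v
  adjacent⇒≢ {u} uv refl = contradiction (trans (sym uv) (irrefl G u)) λ ()

  ≢-if-separated : ∀ {u v w} → adj G u w ≡ false → adj G v w ≡ true → u ≢ v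
  ≢-if-separated uw vw refl = contradiction (trans (sym uw) vw) λ ()

  Misses : Fin n × Fin n → Fin n → Set
  Misses (a , b) u = adj G u a ≡ false × adj G u b ≡ false

  NonAdjacentPair : Fin n × Fin n → Set
  NonAdjacentPair (a , b) = a ≢ b × adj G a b ≡ false

  induced-copy : ∀ {k} {H : Graph k} (f : Fin k → Fin n) →
                 AllPairs (λ i j → adj G (f i) (f j) ≡ adj H i j × f i ≢ f j) (allFin k) →
                 InducedCopy H G
  induced-copy {H = H} f pairs = record { f = f ; inj = injective ; preserve = preserves }
    where
    preserves : ∀ i j → adj G (f i) (f j) ≡ adj H i j
    preserves i j with <-cmp i j
    ... | tri< i<j _ _ = proj₁ (AllPairs-tabulate⁻ pairs i<j)
    ... | tri≈ _ refl _ = trans (irrefl G (f i)) (sym (irrefl H i))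
    ... | tri> _ _ j<i = trans (adj-flip (proj₁ (AllPairs-tabulate⁻ pairs j<i))) (Graph.sym H j i)

    injective : Injective _≡_ _≡_ f
    injective {i} {j} eq with <-cmp i j
    ... | tri< i<j _ _ = contradiction eq (proj₂ (AllPairs-tabulate⁻ pairs i<j))
    ... | tri≈ _ i≡j _ = i≡j
    ... | tri> _ _ j<i = contradiction (sym eq) (proj₂ (AllPairs-tabulate⁻ pairs j<i))

  K4-e-copy : ∀ {a b p q} → p ≢ q →
              adj G a b ≡ true → adj G a p ≡ true → adj G a q ≡ true →
              adj G b p ≡ true → adj G b q ≡ true → adj G p q ≡ false →
              InducedCopy K4-e G
  K4-e-copy {a} {b} {p} {q} p≢q ab ap aq bp bq pq =
    induced-copy (Vec.lookup (a Vec.∷ b Vec.∷ p Vec.∷ q Vec.∷ Vec.[]))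
    ( ((ab , adjacent⇒≢ ab) ∷ (ap , adjacent⇒≢ ap) ∷ (aq , adjacent⇒≢ aq) ∷ [])
    ∷ ((bp , adjacent⇒≢ bp) ∷ (bq , adjacent⇒≢ bq) ∷ [])
    ∷ ((pq , p≢q) ∷ [])
    ∷ []
    ∷ [])

  twoP1+P3-copy : ∀ {a b p q r} → a ≢ b → p ≢ r →
                  adj G a b ≡ false → adj G a p ≡ false → adj G a q ≡ false → adj G a r ≡ false →
                  adj G b p ≡ false → adj G b q ≡ false → adj G b r ≡ false →
                  adj G p q ≡ true → adj G p r ≡ false → adj G q r ≡ true →
                  InducedCopy twoP1+P3 G
  twoP1+P3-copy {a} {b} {p} {q} {r} a≢b p≢r ab ap aq ar bp bq br pq pr qr =
    induced-copy (Vec.lookup (a Vec.∷ b Vec.∷ p Vec.∷ q Vec.∷ r Vec.∷ Vec.[]))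
    ( ((ab , a≢b) ∷ (ap , ≢-if-separated aq pq) ∷ (aq , ≢-if-separated ap qp)
                  ∷ (ar , ≢-if-separated aq rq) ∷ [])
    ∷ ((bp , ≢-if-separated bq pq) ∷ (bq , ≢-if-separated bp qp) ∷ (br , ≢-if-separated bq rq) ∷ [])
    ∷ ((pq , adjacent⇒≢ pq) ∷ (pr , p≢r) ∷ [])
    ∷ ((qr , adjacent⇒≢ qr) ∷ [])
    ∷ []
    ∷ [])
    where
    qp : adj G q p ≡ true
    qp = adj-flip pq

    rq : adj G r q ≡ true
    rq = adj-flip qr

module _ {n} (G : Graph n) (2P1+P3-free : Free twoP1+P3 G) (K4-e-free : Free K4-e G) where

  unique-common-neighbour-missing :
    ∀ {a b x z} → NonAdjacentPair G (a , b) → Misses G (a , b) x → x ≢ z → adj G x z ≡ false →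
    ∀ {u w} → adj G u x ≡ true → adj G u z ≡ true → Misses G (a , b) u →
              adj G w x ≡ true → adj G w z ≡ true → Misses G (a , b) w → u ≡ w
  unique-common-neighbour-missing (a≢b , ab) (xa , xb) x≢z xz {u} {w} ux uz (ua , ub) wx wz (wa , wb)
    with u ≟ w | adj G u w in uw
  ... | yes u≡w | _ = u≡w
  ... | no _   | true = ⊥-elim (K4-e-free (K4-e-copy G x≢z uw ux uz wx wz xz))
  ... | no u≢w | false = ⊥-elim (2P1+P3-free (twoP1+P3-copy G a≢b u≢w ab
        (adj-flip G ua) (adj-flip G xa) (adj-flip G wa)
        (adj-flip G ub) (adj-flip G xb) (adj-flip G wb)
        ux uw (adj-flip G wx)))

module CycleNeighbourhood {n} (G : Graph n) (2P1+P3-free : Free twoP1+P3 G) (K4-e-free : Free K4-e G)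
                         (copy : InducedCopy C5+K1 G) where

  c : Fin 6 → Fin n
  c = f copy

  c₀ c₁ c₂ c₃ c₄ x : Fin n
  c₀ = c (# 0)
  c₁ = c (# 1)
  c₂ = c (# 2)
  c₃ = c (# 3)
  c₄ = c (# 4)
  x  = c (# 5)

  edge : ∀ i j → adj G (c i) (c j) ≡ C5+K1-adj i j
  edge = preserve copy

  c-≢ : ∀ i j {i≢j : False (i ≟ j)} → c i ≢ c j
  c-≢ i j {i≢j} eq = toWitnessFalse i≢j (inj copy eq)

  nonEdge : Fin 3 → Fin n × Fin n
  nonEdge zero             = c₁ , c₃
  nonEdge (suc zero)       = c₂ , c₄
  nonEdge (suc (suc zero)) = c₁ , c₄

  nonEdge-nonAdjacent : ∀ i → NonAdjacentPair G (nonEdge i)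
  nonEdge-nonAdjacent zero             = c-≢ (# 1) (# 3) , edge (# 1) (# 3)
  nonEdge-nonAdjacent (suc zero)       = c-≢ (# 2) (# 4) , edge (# 2) (# 4)
  nonEdge-nonAdjacent (suc (suc zero)) = c-≢ (# 1) (# 4) , edge (# 1) (# 4)

  x-misses-nonEdge : ∀ i → Misses G (nonEdge i) x
  x-misses-nonEdge zero             = edge (# 5) (# 1) , edge (# 5) (# 3)
  x-misses-nonEdge (suc zero)       = edge (# 5) (# 2) , edge (# 5) (# 4)
  x-misses-nonEdge (suc (suc zero)) = edge (# 5) (# 1) , edge (# 5) (# 4)

  neighbour-misses-nonEdge : ∀ {u} → adj G c₀ u ≡ true → ∃ λ i → Misses G (nonEdge i) u
  neighbour-misses-nonEdge {u} c₀u with adj G u c₁ in uc₁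
  ... | false with adj G u c₃ in uc₃
  ...   | false = # 0 , uc₁ , uc₃
  ...   | true with adj G u c₄ in uc₄
  ...     | false = # 2 , uc₁ , uc₄
  ...     | true = ⊥-elim (K4-e-free (K4-e-copy G (c-≢ (# 3) (# 0))
                     (adj-flip G uc₄) (edge (# 4) (# 3)) (edge (# 4) (# 0))
                     uc₃ (adj-flip G c₀u) (edge (# 3) (# 0))))
  neighbour-misses-nonEdge {u} c₀u | true with adj G u c₂ in uc₂ | adj G u c₄ in uc₄
  ... | true | _ = ⊥-elim (K4-e-free (K4-e-copy G (c-≢ (# 0) (# 2))
                     (adj-flip G uc₁) (edge (# 1) (# 0)) (edge (# 1) (# 2))
                     (adj-flip G c₀u) uc₂ (edge (# 0) (# 2))))
  ... | false | true = ⊥-elim (K4-e-free (K4-e-copy G (c-≢ (# 1) (# 4))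
                     c₀u (edge (# 0) (# 1)) (edge (# 0) (# 4))
                     uc₁ uc₄ (edge (# 1) (# 4))))
  ... | false | false = # 1 , uc₂ , uc₄

  neighbour-missing-x⇒⊥ : ∀ {u} → adj G c₀ u ≡ true → u ≢ c₁ → u ≢ c₄ → adj G u x ≡ false →
                           ∀ i → Misses G (nonEdge i) u → ⊥
  neighbour-missing-x⇒⊥ c₀u u≢c₁ u≢c₄ ux zero (uc₁ , uc₃) =
    2P1+P3-free (twoP1+P3-copy G (c-≢ (# 5) (# 3)) u≢c₁ (edge (# 5) (# 3))
      (adj-flip G ux) (edge (# 5) (# 0)) (edge (# 5) (# 1))
      (adj-flip G uc₃) (edge (# 3) (# 0)) (edge (# 3) (# 1))
      (adj-flip G c₀u) uc₁ (edge (# 0) (# 1)))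
  neighbour-missing-x⇒⊥ c₀u u≢c₁ u≢c₄ ux (suc zero) (uc₂ , uc₄) =
    2P1+P3-free (twoP1+P3-copy G (c-≢ (# 5) (# 2)) u≢c₄ (edge (# 5) (# 2))
      (adj-flip G ux) (edge (# 5) (# 0)) (edge (# 5) (# 4))
      (adj-flip G uc₂) (edge (# 2) (# 0)) (edge (# 2) (# 4))
      (adj-flip G c₀u) uc₄ (edge (# 0) (# 4)))
  neighbour-missing-x⇒⊥ {u} c₀u u≢c₁ u≢c₄ ux (suc (suc zero)) (uc₁ , uc₄) with adj G u c₂ in uc₂
  ... | false = neighbour-missing-x⇒⊥ c₀u u≢c₁ u≢c₄ ux (# 1) (uc₂ , uc₄)
  ... | true = 2P1+P3-free (twoP1+P3-copy G (c-≢ (# 5) (# 4)) u≢c₁ (edge (# 5) (# 4))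
      (adj-flip G ux) (edge (# 5) (# 2)) (edge (# 5) (# 1))
      (adj-flip G uc₄) (edge (# 4) (# 2)) (edge (# 4) (# 1))
      uc₂ uc₁ (edge (# 2) (# 1)))

  neighbour-adjacent-to-x : ∀ {u} → adj G c₀ u ≡ true → u ≢ c₁ → u ≢ c₄ → adj G u x ≡ true
  neighbour-adjacent-to-x {u} c₀u u≢c₁ u≢c₄ with adj G u x in ux
  ... | true = refl
  ... | false = ⊥-elim (let i , m = neighbour-misses-nonEdge c₀u in
                        neighbour-missing-x⇒⊥ c₀u u≢c₁ u≢c₄ ux i m)

  Class : Fin 5 → Fin n → Set
  Class zero          u = u ≡ c₁
  Class (suc zero)    u = u ≡ c₄
  Class (suc (suc i)) u = adj G u x ≡ true × Misses G (nonEdge i) u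

  neighbour-classified : ∀ {u} → adj G c₀ u ≡ true → ∃ λ i → Class i u
  neighbour-classified {u} c₀u with u ≟ c₁ | u ≟ c₄
  ... | yes u≡c₁ | _        = # 0 , u≡c₁
  ... | no _     | yes u≡c₄ = # 1 , u≡c₄
  ... | no u≢c₁  | no u≢c₄  =
    let i , m = neighbour-misses-nonEdge c₀u in
    suc (suc i) , neighbour-adjacent-to-x c₀u u≢c₁ u≢c₄ , m

  class-subsingleton : ∀ {i u w} → adj G c₀ u ≡ true → adj G c₀ w ≡ true →
                       Class i u → Class i w → u ≡ w
  class-subsingleton {zero}       _   _   u≡c₁ w≡c₁ = trans u≡c₁ (sym w≡c₁)
  class-subsingleton {suc zero}   _   _   u≡c₄ w≡c₄ = trans u≡c₄ (sym w≡c₄)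
  class-subsingleton {suc (suc i)} c₀u c₀w (ux , mu) (wx , mw) =
    unique-common-neighbour-missing G 2P1+P3-free K4-e-free
      (nonEdge-nonAdjacent i) (x-misses-nonEdge i) (c-≢ (# 5) (# 0)) (edge (# 5) (# 0))
      ux (adj-flip G c₀u) mu wx (adj-flip G c₀w) mw

lemma5p2 : ∀ {n} (G : Graph n) → Free twoP1+P3 G → Free K4-e G
    → InducedCopy C5+K1 G → Σ (Fin n) (λ v → degree G v ≤ 5)
lemma5p2 G 2P1+P3-free K4-e-free copy =
  c₀ , degree≤-if-coveredBySubsingletons G c₀ Class neighbour-classified class-subsingleton
  where open CycleNeighbourhood G 2P1+P3-free K4-e-free copy
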